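{- Let $P\subset\mathbb{R}^2$ be a (2-dimensional) lattice polygon and let $v$ be a lattice point in the relative interior of $P$. Then at least one of the following holds: (i) $v=\tfrac12(v_1+v_2)$ for lattice points $v_1,v_2\in P$ with $v_1\neq v_2$; (ii) $v=\tfrac13(v_1+v_2+v_3)$ for pairwise distinct lattice points $v_1,v_2,v_3\in P$.
   Context: A lattice polygon is a convex polygon with vertices in $\mathbb{Z}^2$; lattice points are points of $\mathbb{Z}^2$. -}

module Defs where

open import Data.Nat using (ℕ; zero; suc; _<_) renaming (_+_ to _+ℕ_)
open import Data.Integer using (ℤ; +_; _+_; _*_; -_)
open import Data.Product using (Σ; _×_; _,_)
open import Data.Vec using (Vec; []; _∷_)
open import Relation.Binary.PropositionalEquality using (_≡_)

Point : Set
Point = ℤ × ℤ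

_⊕_ : Point → Point → Point
(a , b) ⊕ (c , d) = (a + c , b + d)

_·_ : ℤ → Point → Point
k · (a , b) = (k * a , k * b)

wsum : ∀ {n} → Vec ℕ n → ℕ
wsum []       = 0
wsum (w ∷ ws) = w +ℕ wsum ws

comb : ∀ {n} → Vec ℕ n → Vec Point n → Point
comb []       []       = (+ 0 , + 0)
comb (w ∷ ws) (v ∷ vs) = ((+ w) · v) ⊕ comb ws vs

-- The rational point q/d (q ∈ ℤ², d a positive natural) lies in the convex hull
-- conv(S) of the finite set of lattice points S.  A rational point lies in conv(S)
-- iff it is a convex combination with rational coefficients; clearing denominators,
-- iff there are natural weights wᵢ with W = Σ wᵢ > 0 and  Σ (wᵢ/W) vᵢ = q/d,
-- i.e.  d · Σ wᵢ vᵢ = W · q.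
InConvQ : ∀ {n} → Vec Point n → Point → ℕ → Set
InConvQ S q d =
  Σ (Vec ℕ _) λ w → (0 < wsum w) × ((+ d) · comb w S ≡ (+ wsum w) · q)

InPoly : ∀ {n} → Vec Point n → Point → Set
InPoly S p = InConvQ S p 1

-- Lattice point p lies in the interior of P = conv(S): there is k > 0 such that
-- the four points p ± (1/k)e₁, p ± (1/k)e₂ lie in P.  Since P is convex this is
-- equivalent to P containing a neighbourhood of p (the diamond spanned by these
-- four points contains the open ball of radius 1/(k√2) around p).
InInterior : ∀ {n} → Vec Point n → Point → Set
InInterior S p =
  Σ ℕ λ k → (0 < k)
    × InConvQ S (((+ k) · p) ⊕ (+ 1 , + 0)) k
    × InConvQ S (((+ k) · p) ⊕ (- (+ 1) , + 0)) k
    × InConvQ S (((+ k) · p) ⊕ (+ 0 , + 1)) k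
    × InConvQ S (((+ k) · p) ⊕ (+ 0 , - (+ 1))) k

-- Move v to the origin.  Since 0 is the midpoint of the rational points ±e₁/k of P, nonnegative
-- weights on the vertices of P, not all carried by the origin, sum them to 0.  A Carathéodory-type
-- argument in the plane turns these into either two vertices on opposite rays from 0, or three
-- vertices a, b, c with det(b,c), det(c,a), det(a,b) > 0, that is, with 0 inside the triangle abc.
-- In the first case convexity puts some z ≠ 0 and -z into P, which is (i).  In the second case, if
-- D = det(a,b) ≥ 2 then ℤa + ℤb is a proper sublattice, so some lattice point q ≠ 0 has
-- Dq = sa + tb with 0 ≤ s, t < D and s + t ≤ D; q lies in P, and replacing a or b by q gives a
-- lattice triangle around 0 of smaller area, unless 0 lies on the segment cq, which is (i) again.
-- The descent stops when all three determinants are 1, and then the identity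
-- det(b,c)·a + det(c,a)·b + det(a,b)·c = 0 reads a + b + c = 0, which is (ii).

{-# OPTIONS --safe #-}
module Submission where

open import Defs
open import Data.Nat using (ℕ)
open import Data.Integer using (+_)
open import Data.Product using (Σ; _×_; _,_)
open import Data.Sum using (_⊎_)
open import Data.Vec using (Vec)
open import Relation.Binary.PropositionalEquality using (_≡_; _≢_)

import Algebra.Properties.CommutativeSemigroup as CommutativeSemigroupProperties
open import Data.Bool using (if_then_else_)
open import Data.Empty using (⊥; ⊥-elim)
open import Data.Fin using (Fin; zero; suc)
open import Data.Fin.Properties using (any?)
open import Data.Integer.Base as ℤ
  using (ℤ; 0ℤ; +[1+_]; -[1+_]; _+_; _-_; _*_; -_; _≤_; _<_; ∣_∣; +≤+; +<+; _%ℕ_; _/ℕ_)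
open import Data.Integer.DivMod using (a≡a%ℕn+[a/ℕn]*n; n%ℕd<d)
open import Data.Integer.Divisibility.Signed
  using (_∣_; divides; ∣-trans; *-monoʳ-∣; *-monoˡ-∣; ∣m∣n⇒∣m-n; *-cancelˡ-∣; ∣⇒∣ᵤ)
import Data.Integer.Properties as ℤₚ
open import Algebra.Properties.AbelianGroup ℤₚ.+-0-abelianGroup using (∙-cancelˡ)
open import Data.Integer.Tactic.RingSolver using (solve-∀)
open import Data.Nat.Base as ℕ using (z≤n; s≤s)
open import Data.Nat.Divisibility using (∣1⇒≡1)
open import Data.Nat.Induction using (<-wellFounded)
import Data.Nat.Properties as ℕₚ
import Data.Nat.Tactic.RingSolver as ℕSolver
open import Data.Product using (proj₁; proj₂; Σ-syntax)
import Data.Product.Properties as Productₚ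
open import Data.Sum using (inj₁; inj₂)
import Data.Sum as Sum
open import Data.Vec using ([]; _∷_; lookup; map; zipWith; replicate)
import Data.Vec.Properties as Vecₚ
open import Function using (_∘_)
open import Function.Bundles using (_⇔_; mk⇔; Equivalence)
open import Induction.WellFounded using (Acc; acc)
open import Relation.Binary.Definitions using (tri<; tri≈; tri>)
open import Relation.Binary.PropositionalEquality
  using (refl; sym; trans; cong; cong₂; subst; subst₂; module ≡-Reasoning)
open import Relation.Nullary using (¬_; Dec; yes; no; does)
open import Relation.Nullary.Decidable using (_×-dec_; ¬?)
open import Relation.Unary using (Decidable)

0ᵖ : Point
0ᵖ = (+ 0 , + 0)

-ᵖ_ : Point → Point
-ᵖ (x₁ , x₂) = (- x₁ , - x₂)

_⊖_ : Point → Point → Point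
(x₁ , x₂) ⊖ (y₁ , y₂) = (x₁ - y₁ , x₂ - y₂)

_≟ᵖ_ : (p q : Point) → Dec (p ≡ q)
_≟ᵖ_ = Productₚ.≡-dec ℤₚ._≟_ ℤₚ._≟_

⊕-comm : ∀ p q → p ⊕ q ≡ q ⊕ p
⊕-comm (x₁ , x₂) (y₁ , y₂) = cong₂ _,_ (ℤₚ.+-comm x₁ y₁) (ℤₚ.+-comm x₂ y₂)

⊕-assoc : ∀ p q r → (p ⊕ q) ⊕ r ≡ p ⊕ (q ⊕ r)
⊕-assoc (x₁ , x₂) (y₁ , y₂) (z₁ , z₂) = cong₂ _,_ (ℤₚ.+-assoc x₁ y₁ z₁) (ℤₚ.+-assoc x₂ y₂ z₂)

⊕-identityˡ : ∀ p → 0ᵖ ⊕ p ≡ p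
⊕-identityˡ (x₁ , x₂) = cong₂ _,_ (ℤₚ.+-identityˡ x₁) (ℤₚ.+-identityˡ x₂)

⊕-identityʳ : ∀ p → p ⊕ 0ᵖ ≡ p
⊕-identityʳ (x₁ , x₂) = cong₂ _,_ (ℤₚ.+-identityʳ x₁) (ℤₚ.+-identityʳ x₂)

⊕-interchange : ∀ p q r s → (p ⊕ q) ⊕ (r ⊕ s) ≡ (p ⊕ r) ⊕ (q ⊕ s)
⊕-interchange (p₁ , p₂) (q₁ , q₂) (r₁ , r₂) (s₁ , s₂) =
  cong₂ _,_ (interchange p₁ q₁ r₁ s₁) (interchange p₂ q₂ r₂ s₂)
  where open CommutativeSemigroupProperties ℤₚ.+-commutativeSemigroup using (interchange)

⊕-cancelˡ : ∀ v p q → v ⊕ p ≡ v ⊕ q → p ≡ q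
⊕-cancelˡ (v₁ , v₂) (p₁ , p₂) (q₁ , q₂) eq =
  cong₂ _,_ (∙-cancelˡ v₁ p₁ q₁ (cong proj₁ eq)) (∙-cancelˡ v₂ p₂ q₂ (cong proj₂ eq))

·-identityˡ : ∀ p → (+ 1) · p ≡ p
·-identityˡ (x₁ , x₂) = cong₂ _,_ (ℤₚ.*-identityˡ x₁) (ℤₚ.*-identityˡ x₂)

·-zeroʳ : ∀ k → k · 0ᵖ ≡ 0ᵖ
·-zeroʳ k = cong₂ _,_ (ℤₚ.*-zeroʳ k) (ℤₚ.*-zeroʳ k)

·-assoc : ∀ k l p → k · (l · p) ≡ (k * l) · p
·-assoc k l (x₁ , x₂) = cong₂ _,_ (sym (ℤₚ.*-assoc k l x₁)) (sym (ℤₚ.*-assoc k l x₂))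

·-ℕ-assoc : ∀ m n p → (+ m) · ((+ n) · p) ≡ (+ (m ℕ.* n)) · p
·-ℕ-assoc m n p = trans (·-assoc (+ m) (+ n) p) (cong (_· p) (sym (ℤₚ.pos-* m n)))

rescale : ∀ m n k l p → m ℕ.* n ≡ k ℕ.* l → (+ m) · ((+ n) · p) ≡ (+ k) · ((+ l) · p)
rescale m n k l p eq =
  trans (·-ℕ-assoc m n p) (trans (cong (λ j → (+ j) · p) eq) (sym (·-ℕ-assoc k l p)))

·-comm : ∀ k l p → k · (l · p) ≡ l · (k · p)
·-comm k l (x₁ , x₂) = cong₂ _,_ (swap k l x₁) (swap k l x₂)
  where
  swap : ∀ k l x → k * (l * x) ≡ l * (k * x)
  swap = solve-∀

·-distribˡ-⊕ : ∀ k p q → k · (p ⊕ q) ≡ (k · p) ⊕ (k · q)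
·-distribˡ-⊕ k (x₁ , x₂) (y₁ , y₂) = cong₂ _,_ (ℤₚ.*-distribˡ-+ k x₁ y₁) (ℤₚ.*-distribˡ-+ k x₂ y₂)

·-distribʳ-+ : ∀ k l p → (k + l) · p ≡ (k · p) ⊕ (l · p)
·-distribʳ-+ k l (x₁ , x₂) = cong₂ _,_ (ℤₚ.*-distribʳ-+ x₁ k l) (ℤₚ.*-distribʳ-+ x₂ k l)

·-inverseˡ : ∀ k p → ((- k) · p) ⊕ (k · p) ≡ 0ᵖ
·-inverseˡ k (x₁ , x₂) = cong₂ _,_ (inverse k x₁) (inverse k x₂)
  where
  inverse : ∀ k x → - k * x + k * x ≡ 0ℤ
  inverse = solve-∀

·-cancelˡ : ∀ k p q → 0 ℕ.< k → (+ k) · p ≡ (+ k) · q → p ≡ q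
·-cancelˡ (ℕ.suc k) (x₁ , x₂) (y₁ , y₂) _ eq =
  cong₂ _,_ (ℤₚ.*-cancelˡ-≡ (+ ℕ.suc k) x₁ y₁ (cong proj₁ eq)) (ℤₚ.*-cancelˡ-≡ (+ ℕ.suc k) x₂ y₂ (cong proj₂ eq))

opposite-scaled : ∀ {p k y} → p ⊕ (k · y) ≡ 0ᵖ → k · (-ᵖ y) ≡ p
opposite-scaled {p₁ , p₂} {k} {y₁ , y₂} eq =
  cong₂ _,_ (solve-for p₁ y₁ (cong proj₁ eq)) (solve-for p₂ y₂ (cong proj₂ eq))
  where
  rearrange : ∀ p k y → k * - y ≡ p - (p + k * y)
  rearrange = solve-∀
  solve-for : ∀ p y → p + k * y ≡ 0ℤ → k * - y ≡ p
  solve-for p y eq = trans (rearrange p k y) (trans (cong (λ z → p - z) eq) (ℤₚ.+-identityʳ p))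

self-opposite : ∀ {z} → z ≡ -ᵖ z → z ≡ 0ᵖ
self-opposite {z₁ , z₂} eq = cong₂ _,_ (zero-of-self-neg (cong proj₁ eq)) (zero-of-self-neg (cong proj₂ eq))
  where
  zero-of-self-neg : ∀ {x} → x ≡ - x → x ≡ 0ℤ
  zero-of-self-neg {+ 0} _ = refl

det : Point → Point → ℤ
det (x₁ , x₂) (y₁ , y₂) = x₁ * y₂ - x₂ * y₁

dot : Point → Point → ℤ
dot (x₁ , x₂) (y₁ , y₂) = x₁ * y₁ + x₂ * y₂

record IsLinear (φ : Point → ℤ) : Set where
  field
    ⊕-homo : ∀ p q → φ (p ⊕ q) ≡ φ p + φ q
    ·-homo : ∀ k p → φ (k · p) ≡ k * φ p

  0-homo : φ 0ᵖ ≡ 0ℤ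
  0-homo = ·-homo 0ℤ 0ᵖ

  ·⊕-homo : ∀ k p q → φ ((k · p) ⊕ q) ≡ k * φ p + φ q
  ·⊕-homo k p q = trans (⊕-homo (k · p) q) (cong (_+ φ q) (·-homo k p))

  combination : ∀ k p l q → φ ((k · p) ⊕ (l · q)) ≡ k * φ p + l * φ q
  combination k p l q = trans (⊕-homo (k · p) (l · q)) (cong₂ _+_ (·-homo k p) (·-homo l q))

det-linearʳ : ∀ a → IsLinear (det a)
det-linearʳ (a₁ , a₂) = record
  { ⊕-homo = λ (x₁ , x₂) (y₁ , y₂) → additive a₁ a₂ x₁ x₂ y₁ y₂
  ; ·-homo = λ k (x₁ , x₂) → homogeneous a₁ a₂ k x₁ x₂
  }
  where
  additive : ∀ a₁ a₂ x₁ x₂ y₁ y₂ → a₁ * (x₂ + y₂) - a₂ * (x₁ + y₁) ≡ (a₁ * x₂ - a₂ * x₁) + (a₁ * y₂ - a₂ * y₁)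
  additive = solve-∀
  homogeneous : ∀ a₁ a₂ k x₁ x₂ → a₁ * (k * x₂) - a₂ * (k * x₁) ≡ k * (a₁ * x₂ - a₂ * x₁)
  homogeneous = solve-∀

det-linearˡ : ∀ b → IsLinear (λ p → det p b)
det-linearˡ (b₁ , b₂) = record
  { ⊕-homo = λ (x₁ , x₂) (y₁ , y₂) → additive b₁ b₂ x₁ x₂ y₁ y₂
  ; ·-homo = λ k (x₁ , x₂) → homogeneous b₁ b₂ k x₁ x₂
  }
  where
  additive : ∀ b₁ b₂ x₁ x₂ y₁ y₂ → (x₁ + y₁) * b₂ - (x₂ + y₂) * b₁ ≡ (x₁ * b₂ - x₂ * b₁) + (y₁ * b₂ - y₂ * b₁)
  additive = solve-∀
  homogeneous : ∀ b₁ b₂ k x₁ x₂ → (k * x₁) * b₂ - (k * x₂) * b₁ ≡ k * (x₁ * b₂ - x₂ * b₁)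
  homogeneous = solve-∀

dot-linearʳ : ∀ a → IsLinear (dot a)
dot-linearʳ (a₁ , a₂) = record
  { ⊕-homo = λ (x₁ , x₂) (y₁ , y₂) → additive a₁ a₂ x₁ x₂ y₁ y₂
  ; ·-homo = λ k (x₁ , x₂) → homogeneous a₁ a₂ k x₁ x₂
  }
  where
  additive : ∀ a₁ a₂ x₁ x₂ y₁ y₂ → a₁ * (x₁ + y₁) + a₂ * (x₂ + y₂) ≡ (a₁ * x₁ + a₂ * x₂) + (a₁ * y₁ + a₂ * y₂)
  additive = solve-∀
  homogeneous : ∀ a₁ a₂ k x₁ x₂ → a₁ * (k * x₁) + a₂ * (k * x₂) ≡ k * (a₁ * x₁ + a₂ * x₂)
  homogeneous = solve-∀

det-self : ∀ a → det a a ≡ 0ℤ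
det-self (a₁ , a₂) = cancel a₁ a₂
  where
  cancel : ∀ a₁ a₂ → a₁ * a₂ - a₂ * a₁ ≡ 0ℤ
  cancel = solve-∀

det-antisym : ∀ a b → det a b ≡ - det b a
det-antisym (a₁ , a₂) (b₁ , b₂) = antisym a₁ a₂ b₁ b₂
  where
  antisym : ∀ a₁ a₂ b₁ b₂ → a₁ * b₂ - a₂ * b₁ ≡ - (b₁ * a₂ - b₂ * a₁)
  antisym = solve-∀

det-swap-neg : ∀ p q → det p q < 0ℤ → 0ℤ < det q p
det-swap-neg p q pq<0 = subst (0ℤ <_) (sym (det-antisym q p)) (ℤₚ.neg-mono-< pq<0)

det-swap-nonpos : ∀ p q → det p q ≤ 0ℤ → 0ℤ ≤ det q p
det-swap-nonpos p q pq≤0 = subst (0ℤ ≤_) (sym (det-antisym q p)) (ℤₚ.neg-mono-≤ pq≤0)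

det-pos⇒≢ : ∀ {p q} → 0ℤ < det p q → p ≢ q
det-pos⇒≢ {p} pq>0 refl = ℤₚ.<-irrefl (sym (det-self p)) pq>0

cramer : ∀ a b x → det a b · x ≡ (det x b · a) ⊕ (det a x · b)
cramer (a₁ , a₂) (b₁ , b₂) (x₁ , x₂) = cong₂ _,_ (first a₁ a₂ b₁ b₂ x₁ x₂) (second a₁ a₂ b₁ b₂ x₁ x₂)
  where
  first : ∀ a₁ a₂ b₁ b₂ x₁ x₂ → (a₁ * b₂ - a₂ * b₁) * x₁ ≡ (x₁ * b₂ - x₂ * b₁) * a₁ + (a₁ * x₂ - a₂ * x₁) * b₁
  first = solve-∀
  second : ∀ a₁ a₂ b₁ b₂ x₁ x₂ → (a₁ * b₂ - a₂ * b₁) * x₂ ≡ (x₁ * b₂ - x₂ * b₁) * a₂ + (a₁ * x₂ - a₂ * x₁) * b₂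
  second = solve-∀

cramer-coordinates : ∀ {a b q s t} D → 0 ℕ.< D → det a b ≡ + D →
  (+ D) · q ≡ ((+ s) · a) ⊕ ((+ t) · b) → det q b ≡ + s × det a q ≡ + t
cramer-coordinates {a} {b} {q} {s} {t} D D>0 ab≡D eq = cancel (begin
    + D * det q b                       ≡⟨ IsLinear.·-homo (det-linearˡ b) (+ D) q ⟨
    det ((+ D) · q) b                   ≡⟨ cong (λ p → det p b) eq ⟩
    det (((+ s) · a) ⊕ ((+ t) · b)) b   ≡⟨ IsLinear.combination (det-linearˡ b) (+ s) a (+ t) b ⟩
    + s * det a b + + t * det b b       ≡⟨ cong₂ (λ x y → + s * x + + t * y) ab≡D (det-self b) ⟩
    + s * + D + + t * 0ℤ                ≡⟨ first (+ s) (+ D) (+ t) ⟩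
    + D * + s                           ∎)
  , cancel (begin
    + D * det a q                       ≡⟨ IsLinear.·-homo (det-linearʳ a) (+ D) q ⟨
    det a ((+ D) · q)                   ≡⟨ cong (det a) eq ⟩
    det a (((+ s) · a) ⊕ ((+ t) · b))   ≡⟨ IsLinear.combination (det-linearʳ a) (+ s) a (+ t) b ⟩
    + s * det a a + + t * det a b       ≡⟨ cong₂ (λ x y → + s * x + + t * y) (det-self a) ab≡D ⟩
    + s * 0ℤ + + t * + D                ≡⟨ second (+ s) (+ D) (+ t) ⟩
    + D * + t                           ∎)
  where
  open ≡-Reasoning
  cancel : ∀ {x y} → + D * x ≡ + D * y → x ≡ y
  cancel {x} {y} = ℤₚ.*-cancelˡ-≡ (+ D) x y {{ℕ.>-nonZero D>0}}
  first : ∀ s D t → s * D + t * 0ℤ ≡ D * s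
  first = solve-∀
  second : ∀ s D t → s * 0ℤ + t * D ≡ D * t
  second = solve-∀

det-syzygy : ∀ a b c → ((det b c · a) ⊕ (det c a · b)) ⊕ (det a b · c) ≡ 0ᵖ
det-syzygy (a₁ , a₂) (b₁ , b₂) (c₁ , c₂) = cong₂ _,_ (first a₁ a₂ b₁ b₂ c₁ c₂) (second a₁ a₂ b₁ b₂ c₁ c₂)
  where
  first : ∀ a₁ a₂ b₁ b₂ c₁ c₂ →
    ((b₁ * c₂ - b₂ * c₁) * a₁ + (c₁ * a₂ - c₂ * a₁) * b₁) + (a₁ * b₂ - a₂ * b₁) * c₁ ≡ 0ℤ
  first = solve-∀
  second : ∀ a₁ a₂ b₁ b₂ c₁ c₂ →
    ((b₁ * c₂ - b₂ * c₁) * a₂ + (c₁ * a₂ - c₂ * a₁) * b₂) + (a₁ * b₂ - a₂ * b₁) * c₂ ≡ 0ℤ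
  second = solve-∀

det-syzygy-collinear : ∀ a b c → det b c ≡ 0ℤ → (det c a · b) ⊕ (det a b · c) ≡ 0ᵖ
det-syzygy-collinear a b c bc≡0 = begin
  (det c a · b) ⊕ (det a b · c)                     ≡⟨ ⊕-identityˡ ((det c a · b) ⊕ (det a b · c)) ⟨
  0ᵖ ⊕ ((det c a · b) ⊕ (det a b · c))              ≡⟨ ⊕-assoc 0ᵖ (det c a · b) (det a b · c) ⟨
  ((0ℤ · a) ⊕ (det c a · b)) ⊕ (det a b · c)        ≡⟨ cong (λ d → ((d · a) ⊕ (det c a · b)) ⊕ (det a b · c)) bc≡0 ⟨
  ((det b c · a) ⊕ (det c a · b)) ⊕ (det a b · c)   ≡⟨ det-syzygy a b c ⟩
  0ᵖ                                                ∎
  where open ≡-Reasoning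

collinear-projection : ∀ a t → det a t ≡ 0ℤ → dot a a · t ≡ dot a t · a
collinear-projection a@(a₁ , a₂) t@(t₁ , t₂) at≡0 = begin
  dot a a · t                                ≡⟨ cong₂ _,_ (first a₁ a₂ t₁ t₂) (second a₁ a₂ t₁ t₂) ⟩
  (dot a t · a) ⊕ (det a t · (- a₂ , a₁))    ≡⟨ cong (λ d → (dot a t · a) ⊕ (d · (- a₂ , a₁))) at≡0 ⟩
  (dot a t · a) ⊕ 0ᵖ                         ≡⟨ ⊕-identityʳ (dot a t · a) ⟩
  dot a t · a                                ∎
  where
  open ≡-Reasoning
  first : ∀ a₁ a₂ t₁ t₂ → (a₁ * a₁ + a₂ * a₂) * t₁ ≡ (a₁ * t₁ + a₂ * t₂) * a₁ + (a₁ * t₂ - a₂ * t₁) * - a₂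
  first = solve-∀
  second : ∀ a₁ a₂ t₁ t₂ → (a₁ * a₁ + a₂ * a₂) * t₂ ≡ (a₁ * t₁ + a₂ * t₂) * a₂ + (a₁ * t₂ - a₂ * t₁) * a₁
  second = solve-∀

e₁ e₂ : Point
e₁ = (+ 1 , + 0)
e₂ = (+ 0 , + 1)

det-expansion : ∀ a b → det a b ≡ det a e₂ * det e₁ b - det a e₁ * det e₂ b
det-expansion (a₁ , a₂) (b₁ , b₂) = expansion a₁ a₂ b₁ b₂
  where
  expansion : ∀ a₁ a₂ b₁ b₂ → a₁ * b₂ - a₂ * b₁ ≡
    (a₁ * + 1 - a₂ * + 0) * (+ 1 * b₂ - + 0 * b₁) - (a₁ * + 0 - a₂ * + 1) * (+ 0 * b₂ - + 1 * b₁)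
  expansion = solve-∀

nonneg-* : ∀ {x y} → 0ℤ ≤ x → 0ℤ ≤ y → 0ℤ ≤ x * y
nonneg-* {+ m} {+ n} _ _ = subst (0ℤ ≤_) (ℤₚ.pos-* m n) (+≤+ z≤n)

nonneg-cancel : ∀ {k x} → 0ℤ < k → 0ℤ ≤ k * x → 0ℤ ≤ x
nonneg-cancel {+[1+ k ]} {+ x} _ _ = +≤+ z≤n
nonneg-cancel {+ 0} (+<+ ())

weighted-nonneg : ∀ w {z} → (0 ℕ.< w → 0ℤ ≤ z) → 0ℤ ≤ + w * z
weighted-nonneg ℕ.zero _ = +≤+ z≤n
weighted-nonneg (ℕ.suc w) {z} z≥0 = nonneg-* {+ ℕ.suc w} {z} (+≤+ z≤n) (z≥0 (s≤s z≤n))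

weighted-pos : ∀ {w z} → 0 ℕ.< w → 0ℤ < z → 0ℤ < + w * z
weighted-pos {ℕ.suc w} {+[1+ z ]} _ _ = +<+ (s≤s z≤n)
weighted-pos {_} {+ 0} _ (+<+ ())

square-nonneg : ∀ z → 0ℤ ≤ z * z
square-nonneg (+ n) = nonneg-* {+ n} {+ n} (+≤+ z≤n) (+≤+ z≤n)
square-nonneg -[1+ n ] = +≤+ z≤n

square-pos : ∀ {z} → z ≢ 0ℤ → 0ℤ < z * z
square-pos {+ 0} z≢0 = ⊥-elim (z≢0 refl)
square-pos {+[1+ n ]} _ = +<+ (s≤s z≤n)
square-pos { -[1+ n ]} _ = +<+ (s≤s z≤n)

dot-self-pos : ∀ {a} → a ≢ 0ᵖ → 0ℤ < dot a a
dot-self-pos {a₁ , a₂} a≢0 with a₁ ℤₚ.≟ 0ℤ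
... | no a₁≢0 = ℤₚ.+-mono-<-≤ (square-pos a₁≢0) (square-nonneg a₂)
... | yes refl = ℤₚ.+-mono-≤-< (+≤+ z≤n) (square-pos (λ a₂≡0 → a≢0 (cong (0ℤ ,_) a₂≡0)))

∣∣-mono-< : ∀ {x y} → 0ℤ ≤ x → x < y → ∣ x ∣ ℕ.< ∣ y ∣
∣∣-mono-< {+ _} {+ _} _ x<y = ℤₚ.drop‿+<+ x<y

unit-det : ∀ {x} → 0ℤ < x → ¬ 1 ℕ.< ∣ x ∣ → x ≡ + 1
unit-det {+[1+ ℕ.zero ]} _ _ = refl
unit-det {+[1+ ℕ.suc n ]} _ ∣x∣≤1 = ⊥-elim (∣x∣≤1 (s≤s (s≤s z≤n)))
unit-det {+ 0} (+<+ ())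

weight-pos : ∀ {D s x d y} → + D * x ≡ + s * d - y → 0ℤ ≤ y → 0 ℕ.< D → 0ℤ < x → 0 ℕ.< s
weight-pos {s = ℕ.suc s} _ _ _ _ = s≤s z≤n
weight-pos {D} {ℕ.zero} {x} {d} {+ y} Dx≡ _ D>0 x>0 =
  ⊥-elim (ℤₚ.<⇒≱ (weighted-pos D>0 x>0) (subst (_≤ 0ℤ) (sym Dx≡) (ℤₚ.i-j≤i 0ℤ (+ y))))

ratio-bound : ∀ {D s x d y} → + D * x ≡ + s * d - y → 0ℤ ≤ y → s ℕ.< D → 0ℤ < d → x < d
ratio-bound {D} {s} {x} {+[1+ d ]} {+ y} Dx≡ _ s<D _ = ℤₚ.*-cancelˡ-<-nonNeg (+ D)
  (ℤₚ.≤-<-trans (subst (_≤ + s * +[1+ d ]) (sym Dx≡) (ℤₚ.i-j≤i (+ s * +[1+ d ]) (+ y)))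
                (ℤₚ.*-monoʳ-<-pos +[1+ d ] (+<+ s<D)))
ratio-bound {d = + 0} _ _ _ (+<+ ())

collinear-weight-pos : ∀ {s t x y} → 0ℤ ≡ + s * x - + t * y → 0ℤ < y → 0 ℕ.< s ℕ.+ t → 0 ℕ.< s
collinear-weight-pos {ℕ.suc s} _ _ _ = s≤s z≤n
collinear-weight-pos {ℕ.zero} {ℕ.suc t} {x} {+[1+ y ]} () _ _
collinear-weight-pos {ℕ.zero} {_} {_} {+ 0} _ (+<+ ())

negate-difference : ∀ D x X Y → D * x ≡ X - Y → D * - x ≡ Y - X
negate-difference D x X Y eq = trans (sym (ℤₚ.neg-distribʳ-* D x)) (trans (cong -_ eq) (flip X Y))
  where
  flip : ∀ X Y → - (X - Y) ≡ Y - X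
  flip = solve-∀

_+ʷ_ : ∀ {n} → Vec ℕ n → Vec ℕ n → Vec ℕ n
_+ʷ_ = zipWith ℕ._+_

_*ʷ_ : ∀ {n} → ℕ → Vec ℕ n → Vec ℕ n
k *ʷ w = map (k ℕ.*_) w

wsum-+ʷ : ∀ {n} (u w : Vec ℕ n) → wsum (u +ʷ w) ≡ wsum u ℕ.+ wsum w
wsum-+ʷ [] [] = refl
wsum-+ʷ (x ∷ u) (y ∷ w) = trans (cong ((x ℕ.+ y) ℕ.+_) (wsum-+ʷ u w)) (interchange x y (wsum u) (wsum w))
  where open CommutativeSemigroupProperties ℕₚ.+-commutativeSemigroup using (interchange)

wsum-*ʷ : ∀ {n} k (w : Vec ℕ n) → wsum (k *ʷ w) ≡ k ℕ.* wsum w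
wsum-*ʷ k [] = sym (ℕₚ.*-zeroʳ k)
wsum-*ʷ k (x ∷ w) = trans (cong (k ℕ.* x ℕ.+_) (wsum-*ʷ k w)) (sym (ℕₚ.*-distribˡ-+ k x (wsum w)))

comb-+ʷ : ∀ {n} (u w : Vec ℕ n) S → comb (u +ʷ w) S ≡ comb u S ⊕ comb w S
comb-+ʷ [] [] [] = refl
comb-+ʷ (x ∷ u) (y ∷ w) (p ∷ S) = begin
  ((+ (x ℕ.+ y)) · p) ⊕ comb (u +ʷ w) S
    ≡⟨ cong₂ _⊕_ (trans (cong (_· p) (ℤₚ.pos-+ x y)) (·-distribʳ-+ (+ x) (+ y) p)) (comb-+ʷ u w S) ⟩
  (((+ x) · p) ⊕ ((+ y) · p)) ⊕ (comb u S ⊕ comb w S)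
    ≡⟨ ⊕-interchange ((+ x) · p) ((+ y) · p) (comb u S) (comb w S) ⟩
  (((+ x) · p) ⊕ comb u S) ⊕ (((+ y) · p) ⊕ comb w S) ∎
  where open ≡-Reasoning

comb-*ʷ : ∀ {n} k (w : Vec ℕ n) S → comb (k *ʷ w) S ≡ (+ k) · comb w S
comb-*ʷ k [] [] = sym (·-zeroʳ (+ k))
comb-*ʷ k (x ∷ w) (p ∷ S) = begin
  ((+ (k ℕ.* x)) · p) ⊕ comb (k *ʷ w) S
    ≡⟨ cong₂ _⊕_ (trans (cong (_· p) (ℤₚ.pos-* k x)) (sym (·-assoc (+ k) (+ x) p))) (comb-*ʷ k w S) ⟩
  ((+ k) · ((+ x) · p)) ⊕ ((+ k) · comb w S)
    ≡⟨ ·-distribˡ-⊕ (+ k) ((+ x) · p) (comb w S) ⟨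
  (+ k) · (((+ x) · p) ⊕ comb w S) ∎
  where open ≡-Reasoning

comb-translate : ∀ {n} (w : Vec ℕ n) S v → comb w (map (_⊖ v) S) ≡ comb w S ⊖ ((+ wsum w) · v)
comb-translate [] [] v = refl
comb-translate (x ∷ w) (p ∷ S) v@(v₁ , v₂) = begin
  ((+ x) · (p ⊖ v)) ⊕ comb w (map (_⊖ v) S)
    ≡⟨ cong (((+ x) · (p ⊖ v)) ⊕_) (comb-translate w S v) ⟩
  ((+ x) · (p ⊖ v)) ⊕ (comb w S ⊖ ((+ wsum w) · v))
    ≡⟨ cong₂ _,_ (regroup (+ x) (proj₁ p) v₁ (proj₁ (comb w S)) (+ wsum w))
                 (regroup (+ x) (proj₂ p) v₂ (proj₂ (comb w S)) (+ wsum w)) ⟩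
  (((+ x) · p) ⊕ comb w S) ⊖ ((+ x + + wsum w) · v)
    ≡⟨ cong (λ k → (((+ x) · p) ⊕ comb w S) ⊖ (k · v)) (ℤₚ.pos-+ x (wsum w)) ⟨
  (((+ x) · p) ⊕ comb w S) ⊖ ((+ (x ℕ.+ wsum w)) · v) ∎
  where
  open ≡-Reasoning
  regroup : ∀ k p v C l → k * (p - v) + (C - l * v) ≡ (k * p + C) - (k + l) * v
  regroup = solve-∀

wsum-zeros : ∀ n → wsum (replicate n 0) ≡ 0
wsum-zeros ℕ.zero = refl
wsum-zeros (ℕ.suc n) = wsum-zeros n

comb-zeros : ∀ {n} (S : Vec Point n) → comb (replicate n 0) S ≡ 0ᵖ
comb-zeros [] = refl
comb-zeros (p ∷ S) = trans (⊕-identityˡ (comb (replicate _ 0) S)) (comb-zeros S)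

indicator : ∀ {n} → Fin n → Vec ℕ n
indicator zero = 1 ∷ replicate _ 0
indicator (suc i) = 0 ∷ indicator i

wsum-indicator : ∀ {n} (i : Fin n) → wsum (indicator i) ≡ 1
wsum-indicator {ℕ.suc n} zero = cong ℕ.suc (wsum-zeros n)
wsum-indicator (suc i) = wsum-indicator i

comb-indicator : ∀ {n} (i : Fin n) S → comb (indicator i) S ≡ lookup S i
comb-indicator zero (p ∷ S) = trans (cong₂ _⊕_ (·-identityˡ p) (comb-zeros S)) (⊕-identityʳ p)
comb-indicator (suc i) (p ∷ S) = trans (⊕-identityˡ (comb (indicator i) S)) (comb-indicator i S)

nonzero-term : ∀ x p → (+ x) · p ≢ 0ᵖ → 0 ℕ.< x × p ≢ 0ᵖ
nonzero-term ℕ.zero p term≢0 = ⊥-elim (term≢0 refl)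
nonzero-term (ℕ.suc x) p term≢0 = s≤s z≤n , p≢0
  where
  p≢0 : p ≢ 0ᵖ
  p≢0 refl = term≢0 (·-zeroʳ (+ ℕ.suc x))

nonzero-support : ∀ {n} (w : Vec ℕ n) S → comb w S ≢ 0ᵖ → Σ[ i ∈ Fin n ] 0 ℕ.< lookup w i × lookup S i ≢ 0ᵖ
nonzero-support [] [] comb≢0 = ⊥-elim (comb≢0 refl)
nonzero-support (x ∷ w) (p ∷ S) comb≢0 with comb w S ≟ᵖ 0ᵖ
... | no rest≢0 = let (i , wᵢ>0 , Sᵢ≢0) = nonzero-support w S rest≢0 in suc i , wᵢ>0 , Sᵢ≢0
... | yes rest≡0 = zero , nonzero-term x p (λ term≡0 → comb≢0 (cong₂ _⊕_ term≡0 rest≡0))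

module _ {φ : Point → ℤ} (φ-linear : IsLinear φ) where
  open IsLinear φ-linear

  linear-nonneg : ∀ {n} (c : Vec ℕ n) T → (∀ i → 0 ℕ.< lookup c i → 0ℤ ≤ φ (lookup T i)) → 0ℤ ≤ φ (comb c T)
  linear-nonneg [] [] _ = subst (0ℤ ≤_) (sym 0-homo) (+≤+ z≤n)
  linear-nonneg (w ∷ c) (p ∷ T) nonneg = subst (0ℤ ≤_) (sym (·⊕-homo (+ w) p (comb c T)))
    (ℤₚ.+-mono-≤ (weighted-nonneg w (nonneg zero)) (linear-nonneg c T (nonneg ∘ suc)))

  linear-pos : ∀ {n} (c : Vec ℕ n) T → (∀ i → 0 ℕ.< lookup c i → 0ℤ ≤ φ (lookup T i)) →
               ∀ i → 0 ℕ.< lookup c i → 0ℤ < φ (lookup T i) → 0ℤ < φ (comb c T)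
  linear-pos (w ∷ c) (p ∷ T) nonneg zero w>0 φp>0 = subst (0ℤ <_) (sym (·⊕-homo (+ w) p (comb c T)))
    (ℤₚ.+-mono-<-≤ (weighted-pos w>0 φp>0) (linear-nonneg c T (nonneg ∘ suc)))
  linear-pos (w ∷ c) (p ∷ T) nonneg (suc i) cᵢ>0 φᵢ>0 = subst (0ℤ <_) (sym (·⊕-homo (+ w) p (comb c T)))
    (ℤₚ.+-mono-≤-< (weighted-nonneg w (nonneg zero)) (linear-pos c T (nonneg ∘ suc) i cᵢ>0 φᵢ>0))

if-support : ∀ {P : Set} (P? : Dec P) {w} → 0 ℕ.< (if does P? then w else 0) → P
if-support (yes p) _ = p

if-retains : ∀ {P : Set} (P? : Dec P) {w} → P → (if does P? then w else 0) ≡ w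
if-retains (yes _) _ = refl
if-retains (no ¬p) p = ⊥-elim (¬p p)

restrict : ∀ {n} {P : Point → Set} → Decidable P → Vec ℕ n → Vec Point n → Vec ℕ n
restrict P? = zipWith (λ w p → if does (P? p) then w else 0)

module _ {P : Point → Set} (P? : Decidable P) where

  restrict-split : ∀ {n} (c : Vec ℕ n) T → c ≡ restrict P? c T +ʷ restrict (¬? ∘ P?) c T
  restrict-split [] [] = refl
  restrict-split (w ∷ c) (p ∷ T) with P? p
  ... | yes _ = cong₂ _∷_ (sym (ℕₚ.+-identityʳ w)) (restrict-split c T)
  ... | no _ = cong₂ _∷_ refl (restrict-split c T)

  comb-restrict-split : ∀ {n} (c : Vec ℕ n) T → comb c T ≡ comb (restrict P? c T) T ⊕ comb (restrict (¬? ∘ P?) c T) T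
  comb-restrict-split c T =
    trans (cong (λ c′ → comb c′ T) (restrict-split c T)) (comb-+ʷ (restrict P? c T) (restrict (¬? ∘ P?) c T) T)

  restrict-support : ∀ {n} (c : Vec ℕ n) T i → 0 ℕ.< lookup (restrict P? c T) i → P (lookup T i)
  restrict-support c T i pos = if-support (P? (lookup T i)) (subst (0 ℕ.<_) (Vecₚ.lookup-zipWith _ i c T) pos)

  restrict-retains : ∀ {n} (c : Vec ℕ n) T i → P (lookup T i) → lookup (restrict P? c T) i ≡ lookup c i
  restrict-retains c T i p = trans (Vecₚ.lookup-zipWith _ i c T) (if-retains (P? (lookup T i)) p)

translate : ∀ {n} (S : Vec Point n) v q d → InConvQ S (((+ d) · v) ⊕ q) d ⇔ InConvQ (map (_⊖ v) S) q d
translate S v q d = mk⇔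
  (λ (w , W>0 , eq) → w , W>0 ,
     trans (cong ((+ d) ·_) (comb-translate w S v))
           (Equivalence.to (shift-origin (+ d) (+ wsum w) (comb w S) v q) eq))
  (λ (w , W>0 , eq) → w , W>0 ,
     Equivalence.from (shift-origin (+ d) (+ wsum w) (comb w S) v q)
                      (trans (cong ((+ d) ·_) (sym (comb-translate w S v))) eq))
  where
  shift-origin : ∀ (D W : ℤ) (C v q : Point) → D · C ≡ W · ((D · v) ⊕ q) ⇔ D · (C ⊖ (W · v)) ≡ W · q
  shift-origin D W (C₁ , C₂) (v₁ , v₂) (q₁ , q₂) = mk⇔
    (λ eq → cong₂ _,_ (forward (cong proj₁ eq)) (forward (cong proj₂ eq)))
    (λ eq → cong₂ _,_ (backward (cong proj₁ eq)) (backward (cong proj₂ eq)))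
    where
    difference : ∀ D W C v q → D * C - W * (D * v + q) ≡ D * (C - W * v) - W * q
    difference = solve-∀
    forward : ∀ {C v q} → D * C ≡ W * (D * v + q) → D * (C - W * v) ≡ W * q
    forward {C} {v} {q} eq = ℤₚ.i-j≡0⇒i≡j _ _ (trans (sym (difference D W C v q)) (ℤₚ.i≡j⇒i-j≡0 eq))
    backward : ∀ {C v q} → D * (C - W * v) ≡ W * q → D * C ≡ W * (D * v + q)
    backward {C} {v} {q} eq = ℤₚ.i-j≡0⇒i≡j _ _ (trans (difference D W C v q) (ℤₚ.i≡j⇒i-j≡0 eq))

Cone : ∀ {n} → Vec Point n → ℕ → Point → Set
Cone S W X = Σ[ w ∈ Vec ℕ _ ] wsum w ≡ W × comb w S ≡ X

cone-+ : ∀ {n} {S : Vec Point n} {W W′ X X′} → Cone S W X → Cone S W′ X′ → Cone S (W ℕ.+ W′) (X ⊕ X′)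
cone-+ (w , refl , refl) (w′ , refl , refl) = w +ʷ w′ , wsum-+ʷ w w′ , comb-+ʷ w w′ _

cone-* : ∀ {n} {S : Vec Point n} {W X} k → Cone S W X → Cone S (k ℕ.* W) ((+ k) · X)
cone-* k (w , refl , refl) = k *ʷ w , wsum-*ʷ k w , comb-*ʷ k w _

InPoly⇒Cone : ∀ {n} {S : Vec Point n} {p} → InPoly S p → Σ[ W ∈ ℕ ] 0 ℕ.< W × Cone S W ((+ W) · p)
InPoly⇒Cone {S = S} (w , W>0 , eq) = wsum w , W>0 , w , refl , trans (sym (·-identityˡ (comb w S))) eq

Cone⇒InPoly : ∀ {n} {S : Vec Point n} {p W} → 0 ℕ.< W → Cone S W ((+ W) · p) → InPoly S p
Cone⇒InPoly {S = S} W>0 (w , refl , eq) = w , W>0 , trans (·-identityˡ (comb w S)) eq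

cone-combination₃ : ∀ {n} {S : Vec Point n} {a b c U V W} r s t →
  Cone S U ((+ U) · a) → Cone S V ((+ V) · b) → Cone S W ((+ W) · c) →
  Cone S (((U ℕ.* V) ℕ.* W) ℕ.* ((r ℕ.+ s) ℕ.+ t))
         ((+ ((U ℕ.* V) ℕ.* W)) · ((((+ r) · a) ⊕ ((+ s) · b)) ⊕ ((+ t) · c)))
cone-combination₃ {S = S} {a} {b} {c} {U} {V} {W} r s t a-cone b-cone c-cone =
  subst₂ (Cone S) (regroup r s t U V W) point
    (cone-+ (cone-+ (cone-* λᵃ a-cone) (cone-* λᵇ b-cone)) (cone-* λᶜ c-cone))
  where
  open ≡-Reasoning
  K λᵃ λᵇ λᶜ : ℕ
  K = (U ℕ.* V) ℕ.* W
  λᵃ = r ℕ.* (V ℕ.* W)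
  λᵇ = s ℕ.* (U ℕ.* W)
  λᶜ = t ℕ.* (U ℕ.* V)
  regroup : ∀ r s t U V W → (r ℕ.* (V ℕ.* W)) ℕ.* U ℕ.+ (s ℕ.* (U ℕ.* W)) ℕ.* V ℕ.+ (t ℕ.* (U ℕ.* V)) ℕ.* W
                          ≡ ((U ℕ.* V) ℕ.* W) ℕ.* ((r ℕ.+ s) ℕ.+ t)
  regroup = ℕSolver.solve-∀
  factorᵃ : ∀ r U V W → (r ℕ.* (V ℕ.* W)) ℕ.* U ≡ ((U ℕ.* V) ℕ.* W) ℕ.* r
  factorᵃ = ℕSolver.solve-∀
  factorᵇ : ∀ s U V W → (s ℕ.* (U ℕ.* W)) ℕ.* V ≡ ((U ℕ.* V) ℕ.* W) ℕ.* s
  factorᵇ = ℕSolver.solve-∀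
  factorᶜ : ∀ t U V W → (t ℕ.* (U ℕ.* V)) ℕ.* W ≡ ((U ℕ.* V) ℕ.* W) ℕ.* t
  factorᶜ = ℕSolver.solve-∀
  point : (((+ λᵃ) · ((+ U) · a)) ⊕ ((+ λᵇ) · ((+ V) · b))) ⊕ ((+ λᶜ) · ((+ W) · c))
          ≡ (+ K) · ((((+ r) · a) ⊕ ((+ s) · b)) ⊕ ((+ t) · c))
  point = begin
    (((+ λᵃ) · ((+ U) · a)) ⊕ ((+ λᵇ) · ((+ V) · b))) ⊕ ((+ λᶜ) · ((+ W) · c))
      ≡⟨ cong₂ _⊕_ (cong₂ _⊕_ (rescale λᵃ U K r a (factorᵃ r U V W)) (rescale λᵇ V K s b (factorᵇ s U V W)))
                   (rescale λᶜ W K t c (factorᶜ t U V W)) ⟩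
    (((+ K) · ((+ r) · a)) ⊕ ((+ K) · ((+ s) · b))) ⊕ ((+ K) · ((+ t) · c))
      ≡⟨ cong (_⊕ ((+ K) · ((+ t) · c))) (·-distribˡ-⊕ (+ K) ((+ r) · a) ((+ s) · b)) ⟨
    ((+ K) · (((+ r) · a) ⊕ ((+ s) · b))) ⊕ ((+ K) · ((+ t) · c))
      ≡⟨ ·-distribˡ-⊕ (+ K) (((+ r) · a) ⊕ ((+ s) · b)) ((+ t) · c) ⟨
    (+ K) · ((((+ r) · a) ⊕ ((+ s) · b)) ⊕ ((+ t) · c)) ∎

convex₃ : ∀ {n} {S : Vec Point n} {a b c q r s t D} →
  InPoly S a → InPoly S b → InPoly S c → (r ℕ.+ s) ℕ.+ t ≡ D → 0 ℕ.< D →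
  (+ D) · q ≡ (((+ r) · a) ⊕ ((+ s) · b)) ⊕ ((+ t) · c) → InPoly S q
convex₃ {S = S} {a} {b} {c} {q} {r} {s} {t} {D} a∈P b∈P c∈P r+s+t≡D D>0 q-eq
  with InPoly⇒Cone a∈P | InPoly⇒Cone b∈P | InPoly⇒Cone c∈P
... | U , U>0 , a-cone | V , V>0 , b-cone | W , W>0 , c-cone =
  Cone⇒InPoly (ℕₚ.*-mono-≤ (ℕₚ.*-mono-≤ (ℕₚ.*-mono-≤ U>0 V>0) W>0) D>0)
    (subst₂ (Cone S) (cong (K ℕ.*_) r+s+t≡D) (trans (cong ((+ K) ·_) (sym q-eq)) (·-ℕ-assoc K D q))
      (cone-combination₃ r s t a-cone b-cone c-cone))
  where
  K : ℕ
  K = (U ℕ.* V) ℕ.* W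

vertex∈P : ∀ {n} (S : Vec Point n) i → InPoly S (lookup S i)
vertex∈P S i = Cone⇒InPoly (s≤s z≤n)
  (indicator i , wsum-indicator i , trans (comb-indicator i S) (sym (·-identityˡ (lookup S i))))

-- A Carathéodory-type lemma in the plane

opposite-weights-balance : ∀ {n} (T : Vec Point n) {x} K (w w′ : Vec ℕ n) → 0 ℕ.< K →
  (+ K) · comb w T ≡ (+ wsum w) · x → (+ K) · comb w′ T ≡ (+ wsum w′) · (-ᵖ x) →
  comb ((wsum w′ *ʷ w) +ʷ (wsum w *ʷ w′)) T ≡ 0ᵖ
opposite-weights-balance T {x} K w w′ K>0 w-eq w′-eq = ·-cancelˡ K (comb c T) 0ᵖ K>0 (begin
  (+ K) · comb c T
    ≡⟨ cong ((+ K) ·_) (trans (comb-+ʷ (W′ *ʷ w) (W *ʷ w′) T) (cong₂ _⊕_ (comb-*ʷ W′ w T) (comb-*ʷ W w′ T))) ⟩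
  (+ K) · (((+ W′) · comb w T) ⊕ ((+ W) · comb w′ T))
    ≡⟨ ·-distribˡ-⊕ (+ K) ((+ W′) · comb w T) ((+ W) · comb w′ T) ⟩
  ((+ K) · ((+ W′) · comb w T)) ⊕ ((+ K) · ((+ W) · comb w′ T))
    ≡⟨ cong₂ _⊕_ (·-comm (+ K) (+ W′) (comb w T)) (·-comm (+ K) (+ W) (comb w′ T)) ⟩
  ((+ W′) · ((+ K) · comb w T)) ⊕ ((+ W) · ((+ K) · comb w′ T))
    ≡⟨ cong₂ (λ X Y → ((+ W′) · X) ⊕ ((+ W) · Y)) w-eq w′-eq ⟩
  ((+ W′) · ((+ W) · x)) ⊕ ((+ W) · ((+ W′) · (-ᵖ x)))
    ≡⟨ cong₂ _,_ (cancel (+ W′) (+ W) (proj₁ x)) (cancel (+ W′) (+ W) (proj₂ x)) ⟩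
  0ᵖ
    ≡⟨ ·-zeroʳ (+ K) ⟨
  (+ K) · 0ᵖ ∎)
  where
  open ≡-Reasoning
  W W′ : ℕ
  W = wsum w
  W′ = wsum w′
  c : Vec ℕ _
  c = (W′ *ʷ w) +ʷ (W *ʷ w′)
  cancel : ∀ m n x → m * (n * x) + n * (m * - x) ≡ 0ℤ
  cancel = solve-∀

balanced-weights : ∀ {n} (T : Vec Point n) {x k} → x ≢ 0ᵖ →
  InConvQ T x (ℕ.suc k) → InConvQ T (-ᵖ x) (ℕ.suc k) →
  Σ[ c ∈ Vec ℕ n ] comb c T ≡ 0ᵖ × Σ[ i ∈ Fin n ] 0 ℕ.< lookup c i × lookup T i ≢ 0ᵖ
balanced-weights {n} T {x} {k} x≢0 (w , W>0 , w-eq) (w′ , W′>0 , w′-eq) =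
  (W′ *ʷ w) +ʷ (W *ʷ w′) , opposite-weights-balance T (ℕ.suc k) w w′ (s≤s z≤n) w-eq w′-eq ,
  i , cᵢ>0 , proj₂ (proj₂ support)
  where
  W W′ : ℕ
  W = wsum w
  W′ = wsum w′
  comb-w≢0 : comb w T ≢ 0ᵖ
  comb-w≢0 comb≡0 = x≢0 (·-cancelˡ W x 0ᵖ W>0 (begin
    (+ W) · x               ≡⟨ w-eq ⟨
    (+ ℕ.suc k) · comb w T  ≡⟨ cong ((+ ℕ.suc k) ·_) comb≡0 ⟩
    (+ ℕ.suc k) · 0ᵖ        ≡⟨ ·-zeroʳ (+ ℕ.suc k) ⟩
    0ᵖ                      ≡⟨ ·-zeroʳ (+ W) ⟨
    (+ W) · 0ᵖ              ∎))
    where open ≡-Reasoning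
  support : Σ[ i ∈ Fin n ] 0 ℕ.< lookup w i × lookup T i ≢ 0ᵖ
  support = nonzero-support w T comb-w≢0
  i : Fin n
  i = proj₁ support
  cᵢ>0 : 0 ℕ.< lookup ((W′ *ʷ w) +ʷ (W *ʷ w′)) i
  cᵢ>0 = subst (0 ℕ.<_) (sym cᵢ-value)
    (ℕₚ.<-≤-trans (ℕₚ.*-mono-≤ W′>0 (proj₁ (proj₂ support))) (ℕₚ.m≤m+n _ _))
    where
    cᵢ-value : lookup ((W′ *ʷ w) +ʷ (W *ʷ w′)) i ≡ W′ ℕ.* lookup w i ℕ.+ W ℕ.* lookup w′ i
    cᵢ-value = trans (Vecₚ.lookup-zipWith ℕ._+_ i (W′ *ʷ w) (W *ʷ w′))
                     (cong₂ ℕ._+_ (Vecₚ.lookup-map i (W′ ℕ.*_) w) (Vecₚ.lookup-map i (W ℕ.*_) w′))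

-- 0 lies strictly between x and y (as soon as x ≢ 0ᵖ).
Opposed : Point → Point → Set
Opposed x y = Σ[ m ∈ ℕ ] Σ[ k ∈ ℕ ] 0 ℕ.< m × 0 ℕ.< k × ((+ m) · x) ⊕ ((+ k) · y) ≡ 0ᵖ

opposed : ∀ {m k x y} → 0ℤ < m → 0ℤ < k → (m · x) ⊕ (k · y) ≡ 0ᵖ → Opposed x y
opposed {+[1+ m ]} {+[1+ k ]} _ _ eq = ℕ.suc m , ℕ.suc k , s≤s z≤n , s≤s z≤n , eq
opposed {+ 0} (+<+ ())
opposed {+[1+ m ]} {+ 0} _ (+<+ ())

-- 0 lies in the interior of the triangle abc.
PositiveTriangle : Point → Point → Point → Set
PositiveTriangle a b c = 0ℤ < det b c × 0ℤ < det c a × 0ℤ < det a b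

module Carathéodory {n} (c : Vec ℕ n) (T : Vec Point n) (balanced : comb c T ≡ 0ᵖ)
                    (i₀ : Fin n) (c₀>0 : 0 ℕ.< lookup c i₀) (a≢0 : lookup T i₀ ≢ 0ᵖ) where

  private
    t : Fin n → Point
    t = lookup T
    a : Point
    a = t i₀
    Left : Point → Set
    Left p = 0ℤ < det a p
    Left? : Decidable Left
    Left? p = 0ℤ ℤₚ.<? det a p
    a-not-left : ¬ Left a
    a-not-left = ℤₚ.<-irrefl (sym (det-self a))

  no-positive-functional : ∀ {φ} → IsLinear φ → (∀ i → 0 ℕ.< lookup c i → 0ℤ ≤ φ (t i)) →
                           ∀ i → 0 ℕ.< lookup c i → 0ℤ < φ (t i) → ⊥
  no-positive-functional {φ} φ-linear nonneg i cᵢ>0 φᵢ>0 =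
    ℤₚ.<-irrefl (sym (IsLinear.0-homo φ-linear))
      (subst (0ℤ <_) (cong φ balanced) (linear-pos φ-linear c T nonneg i cᵢ>0 φᵢ>0))

  -- With B the weighted sum of the support points left of the line ℝa, the functional det(·, B) is
  -- nonnegative on the rest R of the support and positive at a, yet det(R, B) = det(-B, B) = 0.
  left-support-absurd : (∀ j → det a (t j) ≡ 0ℤ → 0ℤ ≤ dot a (t j)) →
                        (∀ i j → Left (t i) → det a (t j) < 0ℤ → det (t i) (t j) < 0ℤ) →
                        ∀ i₁ → 0 ℕ.< lookup c i₁ → Left (t i₁) → ⊥
  left-support-absurd forward separated i₁ c₁>0 left₁ = ℤₚ.<-irrefl (sym det-RB≡0) det-RB>0
    where
    cL cR : Vec ℕ n
    cL = restrict Left? c T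
    cR = restrict (¬? ∘ Left?) c T
    B R : Point
    B = comb cL T
    R = comb cR T
    det-aB>0 : 0ℤ < det a B
    det-aB>0 = linear-pos (det-linearʳ a) cL T (λ i cLᵢ>0 → ℤₚ.<⇒≤ (restrict-support Left? c T i cLᵢ>0))
      i₁ (subst (0 ℕ.<_) (sym (restrict-retains Left? c T i₁ left₁)) c₁>0) left₁
    det-iB≥0 : ∀ i → 0 ℕ.< lookup cR i → 0ℤ ≤ det (t i) B
    det-iB≥0 i cRᵢ>0 with ℤₚ.<-cmp (det a (t i)) 0ℤ
    ... | tri< right _ _ = linear-nonneg (det-linearʳ (t i)) cL T
            (λ j cLⱼ>0 → ℤₚ.<⇒≤ (det-swap-neg (t j) (t i) (separated j i (restrict-support Left? c T j cLⱼ>0) right)))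
    ... | tri≈ _ on _ = nonneg-cancel (dot-self-pos a≢0) (subst (0ℤ ≤_) (sym weighted)
            (nonneg-* {dot a (t i)} {det a B} (forward i on) (ℤₚ.<⇒≤ det-aB>0)))
      where
      weighted : dot a a * det (t i) B ≡ dot a (t i) * det a B
      weighted = trans (sym (IsLinear.·-homo (det-linearˡ B) (dot a a) (t i)))
                   (trans (cong (λ p → det p B) (collinear-projection a (t i) on))
                          (IsLinear.·-homo (det-linearˡ B) (dot a (t i)) a))
    ... | tri> _ _ left = ⊥-elim (restrict-support (¬? ∘ Left?) c T i cRᵢ>0 left)
    det-RB>0 : 0ℤ < det R B
    det-RB>0 = linear-pos (det-linearˡ B) cR T det-iB≥0
      i₀ (subst (0 ℕ.<_) (sym (restrict-retains (¬? ∘ Left?) c T i₀ a-not-left)) c₀>0) det-aB>0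
    det-RB≡0 : det R B ≡ 0ℤ
    det-RB≡0 = begin
      det R B            ≡⟨ ℤₚ.+-identityˡ (det R B) ⟨
      0ℤ + det R B       ≡⟨ cong (_+ det R B) (det-self B) ⟨
      det B B + det R B  ≡⟨ IsLinear.⊕-homo (det-linearˡ B) B R ⟨
      det (B ⊕ R) B      ≡⟨ cong (λ p → det p B) (trans (sym (comb-restrict-split Left? c T)) balanced) ⟩
      det 0ᵖ B           ≡⟨ IsLinear.0-homo (det-linearˡ B) ⟩
      0ℤ                 ∎
      where open ≡-Reasoning

  no-left-support-absurd : (∀ j → det a (t j) ≡ 0ℤ → 0ℤ ≤ dot a (t j)) →
                           (∀ i → 0 ℕ.< lookup c i → ¬ Left (t i)) → ⊥
  no-left-support-absurd forward no-left
    with any? (λ j → (0 ℕₚ.<? lookup c j) ×-dec (det a (t j) ℤₚ.<? 0ℤ))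
  ... | yes (j , cⱼ>0 , right) = no-positive-functional (det-linearˡ a)
          (λ i cᵢ>0 → det-swap-nonpos a (t i) (ℤₚ.≮⇒≥ (no-left i cᵢ>0))) j cⱼ>0 (det-swap-neg a (t j) right)
  ... | no no-right = no-positive-functional (dot-linearʳ a) on-line-forward i₀ c₀>0 (dot-self-pos a≢0)
    where
    on-line-forward : ∀ i → 0 ℕ.< lookup c i → 0ℤ ≤ dot a (t i)
    on-line-forward i cᵢ>0 with ℤₚ.<-cmp (det a (t i)) 0ℤ
    ... | tri< right _ _ = ⊥-elim (no-right (i , cᵢ>0 , right))
    ... | tri≈ _ on _ = forward i on
    ... | tri> _ _ left = ⊥-elim (no-left i cᵢ>0 left)

  impossible : (∀ j → det a (t j) ≡ 0ℤ → 0ℤ ≤ dot a (t j)) →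
               (∀ i j → Left (t i) → det a (t j) < 0ℤ → det (t i) (t j) < 0ℤ) → ⊥
  impossible forward separated with any? (λ i → (0 ℕₚ.<? lookup c i) ×-dec Left? (t i))
  ... | yes (i₁ , c₁>0 , left₁) = left-support-absurd forward separated i₁ c₁>0 left₁
  ... | no no-left = no-left-support-absurd forward (λ i cᵢ>0 left → no-left (i , cᵢ>0 , left))

  Outcome : Set
  Outcome = (Σ[ i ∈ Fin n ] Σ[ j ∈ Fin n ] t i ≢ 0ᵖ × Opposed (t i) (t j))
          ⊎ (Σ[ i ∈ Fin n ] Σ[ j ∈ Fin n ] Σ[ l ∈ Fin n ] PositiveTriangle (t i) (t j) (t l))

  straddling : ∀ i j → Left (t i) → det a (t j) < 0ℤ → 0ℤ ≤ det (t i) (t j) → Outcome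
  straddling i j left right ij≥0 with ℤₚ.<-cmp 0ℤ (det (t i) (t j))
  ... | tri< ij>0 _ _ = inj₂ (i₀ , i , j , ij>0 , det-swap-neg a (t j) right , left)
  ... | tri≈ _ ij≡0 _ = inj₁ (i , j , tᵢ≢0 ,
          opposed (det-swap-neg a (t j) right) left (det-syzygy-collinear a (t i) (t j) (sym ij≡0)))
    where
    tᵢ≢0 : t i ≢ 0ᵖ
    tᵢ≢0 tᵢ≡0 = ℤₚ.<-irrefl (sym (trans (cong (det a) tᵢ≡0) (IsLinear.0-homo (det-linearʳ a)))) left
  ... | tri> _ _ ij<0 = ⊥-elim (ℤₚ.<⇒≱ ij<0 ij≥0)

  opposed-or-triangle : Outcome
  opposed-or-triangle with any? (λ j → (det a (t j) ℤₚ.≟ 0ℤ) ×-dec (dot a (t j) ℤₚ.<? 0ℤ))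
  ... | yes (j , on , backward) = inj₁ (i₀ , j , a≢0 ,
          opposed (ℤₚ.neg-mono-< backward) (dot-self-pos a≢0) backward-pair)
    where
    backward-pair : ((- dot a (t j)) · a) ⊕ (dot a a · t j) ≡ 0ᵖ
    backward-pair = trans (cong (((- dot a (t j)) · a) ⊕_) (collinear-projection a (t j) on))
                          (·-inverseˡ (dot a (t j)) a)
  ... | no no-backward
    with any? (λ i → any? (λ j → Left? (t i) ×-dec (det a (t j) ℤₚ.<? 0ℤ) ×-dec (0ℤ ℤₚ.≤? det (t i) (t j))))
  ...   | yes (i , j , left , right , ij≥0) = straddling i j left right ij≥0
  ...   | no no-straddle = ⊥-elim (impossible
            (λ j on → ℤₚ.≮⇒≥ (λ backward → no-backward (j , on , backward)))
            (λ i j left right → ℤₚ.≰⇒> (λ ij≥0 → no-straddle (i , j , left , right , ij≥0))))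

-- Lattice points of a fundamental parallelogram

record ParallelogramPoint (a b : Point) (D : ℕ) : Set where
  constructor parallelogram-point
  field
    point : Point
    s t : ℕ
    equation : (+ D) · point ≡ ((+ s) · a) ⊕ ((+ t) · b)
    s<D : s ℕ.< D
    t<D : t ℕ.< D
    nontrivial : 0 ℕ.< s ℕ.+ t

reduce-coefficients : ∀ D .{{_ : ℕ.NonZero D}} x a b u w → (+ D) · x ≡ (u · a) ⊕ (w · b) →
  (+ D) · (x ⊖ (((u /ℕ D) · a) ⊕ ((w /ℕ D) · b))) ≡ ((+ (u %ℕ D)) · a) ⊕ ((+ (w %ℕ D)) · b)
reduce-coefficients D (x₁ , x₂) (a₁ , a₂) (b₁ , b₂) u w eq =
  cong₂ _,_ (coordinate x₁ a₁ b₁ (cong proj₁ eq)) (coordinate x₂ a₂ b₂ (cong proj₂ eq))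
  where
  open ≡-Reasoning
  q₁ q₂ : ℤ
  q₁ = u /ℕ D
  q₂ = w /ℕ D
  r₁ r₂ : ℕ
  r₁ = u %ℕ D
  r₂ = w %ℕ D
  expand : ∀ D x q₁ a q₂ b → D * (x - (q₁ * a + q₂ * b)) ≡ D * x - D * (q₁ * a + q₂ * b)
  expand = solve-∀
  collect : ∀ D r₁ q₁ a r₂ q₂ b → (r₁ + q₁ * D) * a + (r₂ + q₂ * D) * b - D * (q₁ * a + q₂ * b) ≡ r₁ * a + r₂ * b
  collect = solve-∀
  coordinate : ∀ x a b → + D * x ≡ u * a + w * b → + D * (x - (q₁ * a + q₂ * b)) ≡ + r₁ * a + + r₂ * b
  coordinate x a b h = begin
    + D * (x - (q₁ * a + q₂ * b))
      ≡⟨ expand (+ D) x q₁ a q₂ b ⟩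
    + D * x - + D * (q₁ * a + q₂ * b)
      ≡⟨ cong (_- + D * (q₁ * a + q₂ * b))
              (trans h (cong₂ (λ U W → U * a + W * b) (a≡a%ℕn+[a/ℕn]*n u D) (a≡a%ℕn+[a/ℕn]*n w D))) ⟩
    (+ r₁ + q₁ * + D) * a + (+ r₂ + q₂ * + D) * b - + D * (q₁ * a + q₂ * b)
      ≡⟨ collect (+ D) (+ r₁) q₁ a (+ r₂) q₂ b ⟩
    + r₁ * a + + r₂ * b ∎

∣-residue : ∀ u D .{{_ : ℕ.NonZero D}} → u %ℕ D ≡ 0 → + D ∣ u
∣-residue u D r≡0 = divides (u /ℕ D)
  (trans (a≡a%ℕn+[a/ℕn]*n u D) (trans (cong (λ r → + r + (u /ℕ D) * + D) r≡0) (ℤₚ.+-identityˡ ((u /ℕ D) * + D))))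

*-pres-∣ : ∀ {k l x y} → k ∣ x → l ∣ y → k * l ∣ x * y
*-pres-∣ {k} {l} {x} k∣x l∣y = ∣-trans (*-monoˡ-∣ l k∣x) (*-monoʳ-∣ x l∣y)

unimodular : ∀ {a b} D .{{_ : ℕ.NonZero D}} → det a b ≡ + D →
  + D ∣ det e₁ b → + D ∣ det a e₁ → + D ∣ det e₂ b → + D ∣ det a e₂ → D ≡ 1
unimodular {a} {b} D ab≡D ∣e₁b ∣ae₁ ∣e₂b ∣ae₂ = ∣1⇒≡1 (∣⇒∣ᵤ (*-cancelˡ-∣ (+ D) D*D∣D*1))
  where
  D*D∣D*1 : + D * + D ∣ + D * + 1
  D*D∣D*1 = subst (+ D * + D ∣_)
    (trans (sym (det-expansion a b)) (trans ab≡D (sym (ℤₚ.*-identityʳ (+ D)))))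
    (∣m∣n⇒∣m-n (*-pres-∣ ∣ae₂ ∣e₁b) (*-pres-∣ ∣ae₁ ∣e₂b))

-- Reduce the coordinates of e₁ and e₂ in the basis a, b modulo D; if all of them vanished, D² would
-- divide det(a,b) = D.
nonzero-residue : ∀ {a b} D → det a b ≡ + D → 1 ℕ.< D → ParallelogramPoint a b D
nonzero-residue {a} {b} D@(ℕ.suc _) ab≡D 1<D = choose (0 ℕₚ.<? r₁ e₁ ℕ.+ r₂ e₁) (0 ℕₚ.<? r₁ e₂ ℕ.+ r₂ e₂)
  where
  r₁ r₂ : Point → ℕ
  r₁ x = det x b %ℕ D
  r₂ x = det a x %ℕ D
  residue : ∀ x → 0 ℕ.< r₁ x ℕ.+ r₂ x → ParallelogramPoint a b D
  residue x r>0 = parallelogram-point _ (r₁ x) (r₂ x)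
    (reduce-coefficients D x a b (det x b) (det a x) (trans (cong (_· x) (sym ab≡D)) (cramer a b x)))
    (n%ℕd<d (det x b) D) (n%ℕd<d (det a x) D) r>0
  divides-both : ∀ x → ¬ 0 ℕ.< r₁ x ℕ.+ r₂ x → (+ D ∣ det x b) × (+ D ∣ det a x)
  divides-both x r≯0 =
    ∣-residue (det x b) D (ℕₚ.m+n≡0⇒m≡0 (r₁ x) r≡0) , ∣-residue (det a x) D (ℕₚ.m+n≡0⇒n≡0 (r₁ x) r≡0)
    where
    r≡0 : r₁ x ℕ.+ r₂ x ≡ 0
    r≡0 = ℕₚ.n≤0⇒n≡0 (ℕₚ.≮⇒≥ r≯0)
  choose : Dec (0 ℕ.< r₁ e₁ ℕ.+ r₂ e₁) → Dec (0 ℕ.< r₁ e₂ ℕ.+ r₂ e₂) → ParallelogramPoint a b D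
  choose (yes r>0) _ = residue e₁ r>0
  choose (no _) (yes r>0) = residue e₂ r>0
  choose (no r≯0) (no r′≯0) with divides-both e₁ r≯0 | divides-both e₂ r′≯0
  ... | ∣e₁b , ∣ae₁ | ∣e₂b , ∣ae₂ = ⊥-elim (ℕₚ.<-irrefl (sym (unimodular {a} {b} D ab≡D ∣e₁b ∣ae₁ ∣e₂b ∣ae₂)) 1<D)

complement-point : ∀ {a b q} D s t s′ t′ → (+ D) · q ≡ ((+ s) · a) ⊕ ((+ t) · b) →
  s ℕ.+ s′ ≡ D → t ℕ.+ t′ ≡ D → (+ D) · ((a ⊕ b) ⊖ q) ≡ ((+ s′) · a) ⊕ ((+ t′) · b)
complement-point {a₁ , a₂} {b₁ , b₂} {q₁ , q₂} D s t s′ t′ eq s+s′≡D t+t′≡D = cong₂ _,_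
  (coordinate a₁ b₁ q₁ (cong proj₁ eq)) (coordinate a₂ b₂ q₂ (cong proj₂ eq))
  where
  open ≡-Reasoning
  split : ∀ {k} l → k ℕ.+ l ≡ D → + D ≡ + k + + l
  split {k} l k+l≡D = trans (cong +_ (sym k+l≡D)) (ℤₚ.pos-+ k l)
  expand : ∀ D a b q → D * ((a + b) - q) ≡ D * a + D * b - D * q
  expand = solve-∀
  collect : ∀ s s′ t t′ a b → (s + s′) * a + (t + t′) * b - (s * a + t * b) ≡ s′ * a + t′ * b
  collect = solve-∀
  coordinate : ∀ a b q → + D * q ≡ + s * a + + t * b → + D * ((a + b) - q) ≡ + s′ * a + + t′ * b
  coordinate a b q Dq≡ = begin
    + D * ((a + b) - q)                                          ≡⟨ expand (+ D) a b q ⟩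
    + D * a + + D * b - + D * q                                  ≡⟨ cong (λ X → + D * a + + D * b - X) Dq≡ ⟩
    + D * a + + D * b - (+ s * a + + t * b)                      ≡⟨ cong₂ (λ X Y → X * a + Y * b - (+ s * a + + t * b))
                                                                       (split s′ s+s′≡D) (split t′ t+t′≡D) ⟩
    (+ s + + s′) * a + (+ t + + t′) * b - (+ s * a + + t * b)    ≡⟨ collect (+ s) (+ s′) (+ t) (+ t′) a b ⟩
    + s′ * a + + t′ * b                                          ∎

complement-sum< : ∀ {D s t s′ t′} → s ℕ.+ s′ ≡ D → t ℕ.+ t′ ≡ D → D ℕ.< s ℕ.+ t → s′ ℕ.+ t′ ℕ.< D
complement-sum< {D} {s} {t} {s′} {t′} s+s′≡D t+t′≡D D<s+t =
  ℕₚ.+-cancelˡ-< D (s′ ℕ.+ t′) D (subst (D ℕ.+ (s′ ℕ.+ t′) ℕ.<_) sum≡2D (ℕₚ.+-monoˡ-< (s′ ℕ.+ t′) D<s+t))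
  where
  open CommutativeSemigroupProperties ℕₚ.+-commutativeSemigroup using (interchange)
  sum≡2D : (s ℕ.+ t) ℕ.+ (s′ ℕ.+ t′) ≡ D ℕ.+ D
  sum≡2D = trans (interchange s t s′ t′) (cong₂ ℕ._+_ s+s′≡D t+t′≡D)

reflect-parallelogram-point : ∀ {a b D} (q : ParallelogramPoint a b D) →
  let open ParallelogramPoint q in D ℕ.< s ℕ.+ t →
  Σ[ q′ ∈ ParallelogramPoint a b D ] ParallelogramPoint.s q′ ℕ.+ ParallelogramPoint.t q′ ℕ.≤ D
reflect-parallelogram-point {a} {b} {D} (parallelogram-point q s t eq s<D t<D _) D<s+t =
  parallelogram-point ((a ⊕ b) ⊖ q) s′ t′ (complement-point D s t s′ t′ eq s+s′≡D t+t′≡D) s′<D t′<D s′+t′>0 ,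
  ℕₚ.<⇒≤ s′+t′<D
  where
  s′ t′ : ℕ
  s′ = D ℕ.∸ s
  t′ = D ℕ.∸ t
  s+s′≡D : s ℕ.+ s′ ≡ D
  s+s′≡D = ℕₚ.m+[n∸m]≡n (ℕₚ.<⇒≤ s<D)
  t+t′≡D : t ℕ.+ t′ ≡ D
  t+t′≡D = ℕₚ.m+[n∸m]≡n (ℕₚ.<⇒≤ t<D)
  s′+t′<D : s′ ℕ.+ t′ ℕ.< D
  s′+t′<D = complement-sum< {D} {s} {t} {s′} {t′} s+s′≡D t+t′≡D D<s+t
  s′<D : s′ ℕ.< D
  s′<D = ℕₚ.≤-<-trans (ℕₚ.m≤m+n s′ t′) s′+t′<D
  t′<D : t′ ℕ.< D
  t′<D = ℕₚ.≤-<-trans (ℕₚ.m≤n+m t′ s′) s′+t′<D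
  s′+t′>0 : 0 ℕ.< s′ ℕ.+ t′
  s′+t′>0 = ℕₚ.<-≤-trans (ℕₚ.m<n⇒0<n∸m s<D) (ℕₚ.m≤m+n s′ t′)

triangle-point : ∀ {a b} D → det a b ≡ + D → 1 ℕ.< D →
  Σ[ q ∈ ParallelogramPoint a b D ] ParallelogramPoint.s q ℕ.+ ParallelogramPoint.t q ℕ.≤ D
triangle-point D ab≡D 1<D with nonzero-residue D ab≡D 1<D
... | q with ParallelogramPoint.s q ℕ.+ ParallelogramPoint.t q ℕₚ.≤? D
...   | yes s+t≤D = q , s+t≤D
...   | no s+t≰D = reflect-parallelogram-point q (ℕₚ.≰⇒> s+t≰D)

-- Descent on lattice triangles around the origin

ZeroIsMidpoint : ∀ {n} → Vec Point n → Set
ZeroIsMidpoint T = Σ[ z ∈ Point ] z ≢ 0ᵖ × InPoly T z × InPoly T (-ᵖ z)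

ZeroIsCentroid : ∀ {n} → Vec Point n → Set
ZeroIsCentroid T = Σ[ a ∈ Point ] Σ[ b ∈ Point ] Σ[ c ∈ Point ]
  InPoly T a × InPoly T b × InPoly T c × a ≢ b × a ≢ c × b ≢ c × ((a ⊕ b) ⊕ c ≡ 0ᵖ)

Centred : ∀ {n} → Vec Point n → Set
Centred T = ZeroIsMidpoint T ⊎ ZeroIsCentroid T

module Descent {n} (T : Vec Point n) (0∈P : InPoly T 0ᵖ) where

  origin-triangle : ∀ {a b q s t D} → InPoly T a → InPoly T b → s ℕ.+ t ℕ.≤ D → 0 ℕ.< D →
                    (+ D) · q ≡ ((+ s) · a) ⊕ ((+ t) · b) → InPoly T q
  origin-triangle {a} {b} {q} {s} {t} {D} a∈P b∈P s+t≤D D>0 eq =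
    convex₃ {r = s} {s = t} {t = r} a∈P b∈P 0∈P (ℕₚ.m+[n∸m]≡n s+t≤D) D>0 (trans eq (begin
      ((+ s) · a) ⊕ ((+ t) · b)
        ≡⟨ ⊕-identityʳ (((+ s) · a) ⊕ ((+ t) · b)) ⟨
      (((+ s) · a) ⊕ ((+ t) · b)) ⊕ 0ᵖ
        ≡⟨ cong ((((+ s) · a) ⊕ ((+ t) · b)) ⊕_) (·-zeroʳ (+ r)) ⟨
      (((+ s) · a) ⊕ ((+ t) · b)) ⊕ ((+ r) · 0ᵖ) ∎))
    where
    open ≡-Reasoning
    r : ℕ
    r = D ℕ.∸ (s ℕ.+ t)

  reflect-opposed : ∀ {x y m k} → InPoly T x → m ℕ.≤ k → 0 ℕ.< k →
                    ((+ m) · x) ⊕ ((+ k) · y) ≡ 0ᵖ → InPoly T (-ᵖ y)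
  reflect-opposed {x} {y} {m} {k} x∈P m≤k k>0 eq =
    origin-triangle {s = m} {0} x∈P x∈P (subst (ℕ._≤ k) (sym (ℕₚ.+-identityʳ m)) m≤k) k>0
      (trans (opposite-scaled {(+ m) · x} {+ k} {y} eq) (sym (⊕-identityʳ ((+ m) · x))))

  midpoint-of-opposed : ∀ {x y} → InPoly T x → InPoly T y → x ≢ 0ᵖ → Opposed x y → ZeroIsMidpoint T
  midpoint-of-opposed {x} {y} x∈P y∈P x≢0 (m , k , m>0 , k>0 , eq) with m ℕₚ.≤? k
  ... | yes m≤k = y , y≢0 , y∈P , reflect-opposed x∈P m≤k k>0 eq
    where
    y≢0 : y ≢ 0ᵖ
    y≢0 refl = x≢0 (·-cancelˡ m x 0ᵖ m>0 (begin
      (+ m) · x                         ≡⟨ ⊕-identityʳ ((+ m) · x) ⟨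
      ((+ m) · x) ⊕ 0ᵖ                  ≡⟨ cong (((+ m) · x) ⊕_) (·-zeroʳ (+ k)) ⟨
      ((+ m) · x) ⊕ ((+ k) · 0ᵖ)        ≡⟨ eq ⟩
      0ᵖ                                ≡⟨ ·-zeroʳ (+ m) ⟨
      (+ m) · 0ᵖ                        ∎))
      where open ≡-Reasoning
  ... | no m≰k = x , x≢0 , x∈P ,
          reflect-opposed y∈P (ℕₚ.<⇒≤ (ℕₚ.≰⇒> m≰k)) m>0 (trans (⊕-comm ((+ k) · y) ((+ m) · x)) eq)

  record Triangle : Set where
    constructor triangle
    field
      a b c : Point
      a∈P : InPoly T a
      b∈P : InPoly T b
      c∈P : InPoly T c
      positive : PositiveTriangle a b c

  -- 0 lies inside abc, so this is twice its area.
  twice-area : Triangle → ℕ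
  twice-area Δ = ∣ det b c ∣ ℕ.+ ∣ det c a ∣ ℕ.+ ∣ det a b ∣
    where open Triangle Δ

  Smaller : Triangle → Set
  Smaller Δ = Σ[ Δ′ ∈ Triangle ] twice-area Δ′ ℕ.< twice-area Δ

  rotate : Triangle → Triangle
  rotate (triangle a b c a∈P b∈P c∈P (bc>0 , ca>0 , ab>0)) = triangle b c a b∈P c∈P a∈P (ca>0 , ab>0 , bc>0)

  rotate-smaller : ∀ Δ → Smaller (rotate Δ) → Smaller Δ
  rotate-smaller Δ@(triangle a b c _ _ _ _) (Δ′ , Δ′<rotated) =
    Δ′ , subst (twice-area Δ′ ℕ.<_) (rotation-invariant (∣ det b c ∣) (∣ det c a ∣) (∣ det a b ∣)) Δ′<rotated
    where
    rotation-invariant : ∀ x y z → y ℕ.+ z ℕ.+ x ≡ x ℕ.+ y ℕ.+ z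
    rotation-invariant x y z = trans (ℕₚ.+-comm (y ℕ.+ z) x) (sym (ℕₚ.+-assoc x y z))

  centroid : ∀ Δ → let open Triangle Δ in det b c ≡ + 1 → det c a ≡ + 1 → det a b ≡ + 1 → ZeroIsCentroid T
  centroid (triangle a b c a∈P b∈P c∈P (bc>0 , ca>0 , ab>0)) bc≡1 ca≡1 ab≡1 =
    a , b , c , a∈P , b∈P , c∈P , det-pos⇒≢ ab>0 , (λ a≡c → det-pos⇒≢ ca>0 (sym a≡c)) , det-pos⇒≢ bc>0 , sum≡0
    where
    open ≡-Reasoning
    sum≡0 : (a ⊕ b) ⊕ c ≡ 0ᵖ
    sum≡0 = begin
      (a ⊕ b) ⊕ c
        ≡⟨ cong₂ _⊕_ (cong₂ _⊕_ (·-identityˡ a) (·-identityˡ b)) (·-identityˡ c) ⟨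
      (((+ 1) · a) ⊕ ((+ 1) · b)) ⊕ ((+ 1) · c)
        ≡⟨ cong₂ (λ x y → ((x · a) ⊕ (y · b)) ⊕ ((+ 1) · c)) bc≡1 ca≡1 ⟨
      ((det b c · a) ⊕ (det c a · b)) ⊕ ((+ 1) · c)
        ≡⟨ cong (λ z → ((det b c · a) ⊕ (det c a · b)) ⊕ (z · c)) ab≡1 ⟨
      ((det b c · a) ⊕ (det c a · b)) ⊕ (det a b · c)
        ≡⟨ det-syzygy a b c ⟩
      0ᵖ ∎

  -- q lies in the triangle 0ab, and the sign of det(c,q) decides whether 0 lies inside qbc, inside aqc,
  -- or on the segment from c to q.
  module Cut {a b c} (a∈P : InPoly T a) (b∈P : InPoly T b) (c∈P : InPoly T c)
             (positive : PositiveTriangle a b c) {D} (ab≡D : det a b ≡ + D) (p : ParallelogramPoint a b D)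
             (s+t≤D : ParallelogramPoint.s p ℕ.+ ParallelogramPoint.t p ℕ.≤ D) where

    open ParallelogramPoint p renaming (point to q)

    Δ : Triangle
    Δ = triangle a b c a∈P b∈P c∈P positive
    bc>0 : 0ℤ < det b c
    bc>0 = proj₁ positive
    ca>0 : 0ℤ < det c a
    ca>0 = proj₁ (proj₂ positive)
    D>0 : 0 ℕ.< D
    D>0 = ℕₚ.≤-<-trans z≤n s<D
    twice-area-Δ : twice-area Δ ≡ ∣ det b c ∣ ℕ.+ ∣ det c a ∣ ℕ.+ D
    twice-area-Δ = cong (∣ det b c ∣ ℕ.+ ∣ det c a ∣ ℕ.+_) (cong ∣_∣ ab≡D)
    q∈P : InPoly T q
    q∈P = origin-triangle {s = s} {t} a∈P b∈P s+t≤D D>0 equation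
    qb≡s : det q b ≡ + s
    qb≡s = proj₁ (cramer-coordinates {a} {b} {q} {s} {t} D D>0 ab≡D equation)
    aq≡t : det a q ≡ + t
    aq≡t = proj₂ (cramer-coordinates {a} {b} {q} {s} {t} D D>0 ab≡D equation)
    D*cq : + D * det c q ≡ + s * det c a - + t * det b c
    D*cq = begin
      + D * det c q                          ≡⟨ IsLinear.·-homo (det-linearʳ c) (+ D) q ⟨
      det c ((+ D) · q)                      ≡⟨ cong (det c) equation ⟩
      det c (((+ s) · a) ⊕ ((+ t) · b))      ≡⟨ IsLinear.combination (det-linearʳ c) (+ s) a (+ t) b ⟩
      + s * det c a + + t * det c b          ≡⟨ cong (λ x → + s * det c a + + t * x) (det-antisym c b) ⟩
      + s * det c a + + t * - det b c        ≡⟨ cong (λ x → + s * det c a + x) (ℤₚ.neg-distribʳ-* (+ t) (det b c)) ⟨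
      + s * det c a - + t * det b c          ∎
      where open ≡-Reasoning

    replace-a : 0ℤ < det c q → Smaller Δ
    replace-a cq>0 = triangle q b c q∈P b∈P c∈P (bc>0 , cq>0 , qb>0) ,
      subst₂ ℕ._<_ (cong (λ k → ∣ det b c ∣ ℕ.+ ∣ det c q ∣ ℕ.+ ∣ k ∣) (sym qb≡s)) (sym twice-area-Δ)
        (ℕₚ.+-mono-≤-< (ℕₚ.+-monoʳ-≤ ∣ det b c ∣ (ℕₚ.<⇒≤ cq<ca)) s<D)
      where
      t*bc≥0 : 0ℤ ≤ + t * det b c
      t*bc≥0 = nonneg-* {+ t} {det b c} (+≤+ z≤n) (ℤₚ.<⇒≤ bc>0)
      qb>0 : 0ℤ < det q b
      qb>0 = subst (0ℤ <_) (sym qb≡s) (+<+ (weight-pos D*cq t*bc≥0 D>0 cq>0))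
      cq<ca : ∣ det c q ∣ ℕ.< ∣ det c a ∣
      cq<ca = ∣∣-mono-< (ℤₚ.<⇒≤ cq>0) (ratio-bound D*cq t*bc≥0 s<D ca>0)

    replace-b : det c q < 0ℤ → Smaller Δ
    replace-b cq<0 = triangle a q c a∈P q∈P c∈P (qc>0 , ca>0 , aq>0) ,
      subst₂ ℕ._<_ (cong (λ k → ∣ det q c ∣ ℕ.+ ∣ det c a ∣ ℕ.+ ∣ k ∣) (sym aq≡t)) (sym twice-area-Δ)
        (ℕₚ.+-mono-≤-< (ℕₚ.+-monoˡ-≤ ∣ det c a ∣ (ℕₚ.<⇒≤ qc<bc)) t<D)
      where
      qc>0 : 0ℤ < det q c
      qc>0 = det-swap-neg c q cq<0
      D*qc : + D * det q c ≡ + t * det b c - + s * det c a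
      D*qc = trans (cong (+ D *_) (det-antisym q c))
                   (negate-difference (+ D) (det c q) (+ s * det c a) (+ t * det b c) D*cq)
      s*ca≥0 : 0ℤ ≤ + s * det c a
      s*ca≥0 = nonneg-* {+ s} {det c a} (+≤+ z≤n) (ℤₚ.<⇒≤ ca>0)
      aq>0 : 0ℤ < det a q
      aq>0 = subst (0ℤ <_) (sym aq≡t) (+<+ (weight-pos D*qc s*ca≥0 D>0 qc>0))
      qc<bc : ∣ det q c ∣ ℕ.< ∣ det b c ∣
      qc<bc = ∣∣-mono-< (ℤₚ.<⇒≤ qc>0) (ratio-bound D*qc s*ca≥0 t<D bc>0)

    through-c : 0ℤ ≡ det c q → ZeroIsMidpoint T
    through-c cq≡0 = midpoint-of-opposed c∈P q∈P c≢0 (opposed qb>0 bc>0 (det-syzygy-collinear b c q (sym cq≡0)))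
      where
      s>0 : 0 ℕ.< s
      s>0 = collinear-weight-pos (trans (sym (ℤₚ.*-zeroʳ (+ D))) (trans (cong (+ D *_) cq≡0) D*cq)) bc>0 nontrivial
      qb>0 : 0ℤ < det q b
      qb>0 = subst (0ℤ <_) (sym qb≡s) (+<+ s>0)
      c≢0 : c ≢ 0ᵖ
      c≢0 c≡0 = ℤₚ.<-irrefl (sym (trans (cong (λ p → det p a) c≡0) (IsLinear.0-homo (det-linearˡ a)))) ca>0

    cut : ZeroIsMidpoint T ⊎ Smaller Δ
    cut with ℤₚ.<-cmp 0ℤ (det c q)
    ... | tri< cq>0 _ _ = inj₂ (replace-a cq>0)
    ... | tri≈ _ cq≡0 _ = inj₁ (through-c cq≡0)
    ... | tri> _ _ cq<0 = inj₂ (replace-b cq<0)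

  shrink : ∀ Δ → 1 ℕ.< ∣ det (Triangle.a Δ) (Triangle.b Δ) ∣ → ZeroIsMidpoint T ⊎ Smaller Δ
  shrink (triangle a b c a∈P b∈P c∈P positive) 1<D =
    Cut.cut a∈P b∈P c∈P positive ab≡D (proj₁ point) (proj₂ point)
    where
    ab≡D : det a b ≡ + ∣ det a b ∣
    ab≡D = sym (ℤₚ.0≤i⇒+∣i∣≡i (ℤₚ.<⇒≤ (proj₂ (proj₂ positive))))
    point : Σ[ p ∈ ParallelogramPoint a b ∣ det a b ∣ ]
              ParallelogramPoint.s p ℕ.+ ParallelogramPoint.t p ℕ.≤ ∣ det a b ∣
    point = triangle-point ∣ det a b ∣ ab≡D 1<D

  step : ∀ Δ → Centred T ⊎ Smaller Δ
  step Δ@(triangle a b c _ _ _ (bc>0 , ca>0 , ab>0))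
    with 1 ℕₚ.<? ∣ det a b ∣ | 1 ℕₚ.<? ∣ det b c ∣ | 1 ℕₚ.<? ∣ det c a ∣
  ... | yes 1<ab | _ | _ = Sum.map₁ inj₁ (shrink Δ 1<ab)
  ... | no _ | yes 1<bc | _ = Sum.map inj₁ (rotate-smaller Δ) (shrink (rotate Δ) 1<bc)
  ... | no _ | no _ | yes 1<ca =
          Sum.map inj₁ (rotate-smaller Δ ∘ rotate-smaller (rotate Δ)) (shrink (rotate (rotate Δ)) 1<ca)
  ... | no ab≯1 | no bc≯1 | no ca≯1 =
          inj₁ (inj₂ (centroid Δ (unit-det bc>0 bc≯1) (unit-det ca>0 ca≯1) (unit-det ab>0 ab≯1)))

  descend : ∀ Δ → Acc ℕ._<_ (twice-area Δ) → Centred T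
  descend Δ (acc smaller) with step Δ
  ... | inj₁ centred = centred
  ... | inj₂ (Δ′ , Δ′<Δ) = descend Δ′ (smaller Δ′<Δ)

midpoint-or-centroid : ∀ {n} (T : Vec Point n) {x k} → InPoly T 0ᵖ → x ≢ 0ᵖ →
  InConvQ T x (ℕ.suc k) → InConvQ T (-ᵖ x) (ℕ.suc k) → Centred T
midpoint-or-centroid T {x} {k} 0∈P x≢0 x∈P -x∈P with balanced-weights T {x} {k} x≢0 x∈P -x∈P
... | c , balanced , i₀ , c₀>0 , a≢0 with Carathéodory.opposed-or-triangle c T balanced i₀ c₀>0 a≢0
...   | inj₁ (i , j , tᵢ≢0 , opp) = inj₁ (Descent.midpoint-of-opposed T 0∈P (vertex∈P T i) (vertex∈P T j) tᵢ≢0 opp)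
...   | inj₂ (i , j , l , positive) = Descent.descend T 0∈P Δ (<-wellFounded (Descent.twice-area T 0∈P Δ))
  where
  Δ : Descent.Triangle T 0∈P
  Δ = Descent.triangle (lookup T i) (lookup T j) (lookup T l) (vertex∈P T i) (vertex∈P T j) (vertex∈P T l) positive

recentre : ∀ {n} (S : Vec Point n) v → Centred (map (_⊖ v) S) →
    (Σ Point λ v₁ → Σ Point λ v₂ →
    InPoly S v₁ × InPoly S v₂ × v₁ ≢ v₂ × (v₁ ⊕ v₂ ≡ (+ 2) · v))
    ⊎
    (Σ Point λ v₁ → Σ Point λ v₂ → Σ Point λ v₃ →
    InPoly S v₁ × InPoly S v₂ × InPoly S v₃ ×
    v₁ ≢ v₂ × v₁ ≢ v₃ × v₂ ≢ v₃ × ((v₁ ⊕ v₂) ⊕ v₃ ≡ (+ 3) · v))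
recentre S v@(v₁ , v₂) (inj₁ (z , z≢0 , z∈P , -z∈P)) =
  inj₁ (v ⊕ z , v ⊕ (-ᵖ z) , shift z∈P , shift -z∈P ,
        (λ eq → z≢0 (self-opposite (⊕-cancelˡ v z (-ᵖ z) eq))) ,
        cong₂ _,_ (double v₁ (proj₁ z)) (double v₂ (proj₂ z)))
  where
  shift : ∀ {p} → InPoly (map (_⊖ v) S) p → InPoly S (v ⊕ p)
  shift {p} p∈P = subst (λ u → InPoly S (u ⊕ p)) (·-identityˡ v) (Equivalence.from (translate S v p 1) p∈P)
  double : ∀ v z → (v + z) + (v + - z) ≡ + 2 * v
  double = solve-∀
recentre S v@(v₁ , v₂) (inj₂ (a , b , c , a∈P , b∈P , c∈P , a≢b , a≢c , b≢c , sum≡0)) =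
  inj₂ (v ⊕ a , v ⊕ b , v ⊕ c , shift a∈P , shift b∈P , shift c∈P ,
        (a≢b ∘ ⊕-cancelˡ v a b) , (a≢c ∘ ⊕-cancelˡ v a c) , (b≢c ∘ ⊕-cancelˡ v b c) ,
        trans (cong₂ _,_ (triple v₁ (proj₁ a) (proj₁ b) (proj₁ c)) (triple v₂ (proj₂ a) (proj₂ b) (proj₂ c)))
              (trans (cong (((+ 3) · v) ⊕_) sum≡0) (⊕-identityʳ ((+ 3) · v))))
  where
  shift : ∀ {p} → InPoly (map (_⊖ v) S) p → InPoly S (v ⊕ p)
  shift {p} p∈P = subst (λ u → InPoly S (u ⊕ p)) (·-identityˡ v) (Equivalence.from (translate S v p 1) p∈P)
  triple : ∀ v a b c → ((v + a) + (v + b)) + (v + c) ≡ + 3 * v + ((a + b) + c)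
  triple = solve-∀

lemma5p7 : (n : ℕ) (S : Vec Point n) (v : Point) → InPoly S v → InInterior S v →
    (Σ Point λ v₁ → Σ Point λ v₂ →
    InPoly S v₁ × InPoly S v₂ × v₁ ≢ v₂ × (v₁ ⊕ v₂ ≡ (+ 2) · v))
    ⊎
    (Σ Point λ v₁ → Σ Point λ v₂ → Σ Point λ v₃ →
    InPoly S v₁ × InPoly S v₂ × InPoly S v₃ ×
    v₁ ≢ v₂ × v₁ ≢ v₃ × v₂ ≢ v₃ × ((v₁ ⊕ v₂) ⊕ v₃ ≡ (+ 3) · v))
lemma5p7 n S v v∈P (ℕ.zero , () , _)
lemma5p7 n S v v∈P (ℕ.suc k , _ , v+e₁/k∈P , v-e₁/k∈P , _ , _) =
  recentre S v (midpoint-or-centroid (map (_⊖ v) S) {e₁} {k} 0∈P e₁≢0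
    (Equivalence.to (translate S v e₁ (ℕ.suc k)) v+e₁/k∈P)
    (Equivalence.to (translate S v (-ᵖ e₁) (ℕ.suc k)) v-e₁/k∈P))
  where
  0∈P : InPoly (map (_⊖ v) S) 0ᵖ
  0∈P = Equivalence.to (translate S v 0ᵖ 1)
    (subst (InPoly S) (sym (trans (⊕-identityʳ ((+ 1) · v)) (·-identityˡ v))) v∈P)
  e₁≢0 : e₁ ≢ 0ᵖ
  e₁≢0 ()
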